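{- Every graph $G$ is $\alpha$-weakly-Helly for some $\alpha\le tb(G)$ and $\alpha\le tl(G)$; that is, the Helly-gap satisfies $\alpha(G)\le tb(G)\le tl(G)$.
   Context: All graphs are finite, simple, undirected, unweighted and connected. $D_G(v,r)=\{u: d_G(u,v)\le r\}$. A graph $G$ is $\alpha$-weakly-Helly if for every family of pairwise intersecting disks $\{D_G(v,r(v)) : v\in S\}$ the disks $D_G(v,r(v)+\alpha)$, $v\in S$, have a common vertex; $\alpha(G)$ is the minimum such $\alpha$. A tree-decomposition of $G$ is a tree $T$ whose nodes are subsets (bags) of $V(G)$ such that every vertex lies in a bag, every edge has both ends in some bag, and the bags containing any fixed vertex induce a subtree of $T$. It has breadth $\rho$ if each bag $B$ satisfies $B\subseteq D_G(v,\rho)$ for some $v\in V(G)$, and length $\lambda$ if each bag has diameter at most $\lambda$ in $G$. The tree-breadth $tb(G)$ and tree-length $tl(G)$ are the minimum breadth and minimum length over all tree-decompositions of $G$. -}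

module Defs where

open import Data.Nat using (ℕ; zero; suc; _+_; _≤_)
open import Data.Bool using (Bool; true; false)
open import Data.Fin using (Fin; zero; suc; toℕ)
open import Data.Fin.Subset using (Subset; _∈_)
open import Data.Product using (Σ; ∃; _×_; _,_)
open import Data.Sum using (_⊎_)
open import Relation.Binary.PropositionalEquality using (_≡_)

data Walk {n : ℕ} (adj : Fin n → Fin n → Bool) : Fin n → Fin n → ℕ → Set where
  here : ∀ {u} → Walk adj u u zero
  step : ∀ {u v w k} → adj u v ≡ true → Walk adj v w k → Walk adj u w (suc k)

record Graph (n : ℕ) : Set where
  field
    adj       : Fin n → Fin n → Bool
    symmetric : ∀ u v → adj u v ≡ adj v u
    loopless  : ∀ v → adj v v ≡ false
    connected : ∀ u v → ∃ λ k → Walk adj u v k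
open Graph public

DistLe : ∀ {n} → Graph n → Fin n → Fin n → ℕ → Set
DistLe G u v r = ∃ λ k → k ≤ r × Walk (adj G) u v k

InDisk : ∀ {n} → Graph n → Fin n → Fin n → ℕ → Set
InDisk G u v r = DistLe G v u r

WeaklyHelly : ∀ {n} → Graph n → ℕ → Set
WeaklyHelly {n} G α =
  (S : Subset n) (r : Fin n → ℕ) →
  (∀ v w → v ∈ S → w ∈ S → ∃ λ x → InDisk G x v (r v) × InDisk G x w (r w)) →
  ∃ λ x → ∀ v → v ∈ S → InDisk G x v (r v + α)

-- Finite trees, on node set Fin (suc m), encoded by parent pointers:
-- node (suc i) has parent (parent i), a node with smaller index.
-- Every finite nonempty tree arises this way (root it at node 0 and
-- number the nodes in BFS order), and every such encoding is a tree.

record Tree : Set where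
  field
    m        : ℕ
    parent   : Fin m → Fin (suc m)
    parent<  : ∀ i → toℕ (parent i) ≤ toℕ i
  Node : Set
  Node = Fin (suc m)
  TEdge : Node → Node → Set
  TEdge a b = ∃ λ i → (a ≡ suc i × b ≡ parent i) ⊎ (b ≡ suc i × a ≡ parent i)

data TPathIn (T : Tree) (P : Tree.Node T → Set) : Tree.Node T → Tree.Node T → Set where
  here : ∀ {a} → P a → TPathIn T P a a
  step : ∀ {a b c} → P a → Tree.TEdge T a b → TPathIn T P b c → TPathIn T P a c

record TreeDecomposition {n : ℕ} (G : Graph n) : Set₁ where
  field
    tree    : Tree
    bag     : Tree.Node tree → Subset n
    covers  : ∀ v → ∃ λ t → v ∈ bag t
    edges   : ∀ u v → adj G u v ≡ true → ∃ λ t → u ∈ bag t × v ∈ bag t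
    subtree : ∀ v s t → v ∈ bag s → v ∈ bag t → TPathIn tree (λ x → v ∈ bag x) s t
open TreeDecomposition public

HasBreadth : ∀ {n} {G : Graph n} → TreeDecomposition G → ℕ → Set
HasBreadth {n} {G} T ρ =
  ∀ t → ∃ λ (v : Fin n) → ∀ u → u ∈ bag T t → InDisk G u v ρ

HasLength : ∀ {n} {G : Graph n} → TreeDecomposition G → ℕ → Set
HasLength {n} {G} T λ' =
  ∀ t → ∀ u w → u ∈ bag T t → w ∈ bag T t → DistLe G u w λ'

TreeBreadthLe : ∀ {n} → Graph n → ℕ → Set₁
TreeBreadthLe G ρ = Σ (TreeDecomposition G) λ T → HasBreadth T ρ

TreeLengthLe : ∀ {n} → Graph n → ℕ → Set₁
TreeLengthLe G λ' = Σ (TreeDecomposition G) λ T → HasLength T λ'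

module Submission where

-- The second inequality is immediate: a bag of diameter ≤ λ lies in the
-- disk of radius λ around any of its vertices.
--
-- For the first, fix a tree-decomposition of breadth ρ.  For a disk
-- D(v,R) the bags meeting it form a subtree of the decomposition tree
-- (the disk is connected in G, and the bags of each vertex form a
-- subtree).  Pairwise intersecting disks give pairwise intersecting
-- subtrees, and subtrees of a tree have the Helly property, so some bag B
-- meets every disk.  As B ⊆ D(c,ρ), every disk D(v, r v + ρ) contains c.

open import Defs
open import Data.Nat using (ℕ; zero; suc; _+_; _≤_; z≤n; s≤s)
open import Data.Nat.Properties
  using (≤-refl; ≤-trans; n≤1+n; +-mono-≤; +-suc; +-identityʳ; <⇒≱; ≤-antisym)
open import Data.Fin using (Fin; zero; suc; toℕ)
open import Data.Fin.Properties using (any?; _≟_; toℕ-injective)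
open import Data.Fin.Subset using (Subset; _∈_)
open import Data.Fin.Subset.Properties using (_∈?_)
open import Data.Bool using (true) renaming (_≟_ to _≟ᵇ_)
open import Data.List using (allFin; filter)
open import Data.List.Extrema.Nat using (argmax; argmin; argmax-all; argmin-all; f[xs]≤f[argmax]; f[argmin]≤f[xs])
open import Data.List.Relation.Unary.All using (lookup)
open import Data.List.Relation.Unary.All.Properties using (all-filter)
open import Data.List.Membership.Propositional.Properties using (∈-filter⁺; ∈-allFin)
open import Data.Product using (Σ; ∃; _×_; _,_; proj₁; proj₂)
open import Data.Sum using (_⊎_; inj₁; inj₂)
open import Data.Empty using (⊥-elim)
open import Relation.Nullary using (Dec; yes; no; _×-dec_)
open import Relation.Unary using (Pred; Decidable)
open import Relation.Binary.PropositionalEquality using (_≡_; refl; sym; trans; subst)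

module Distances {n : ℕ} (G : Graph n) where

  _++ʷ_ : ∀ {a b c k l} → Walk (adj G) a b k → Walk (adj G) b c l → Walk (adj G) a c (k + l)
  here       ++ʷ w' = w'
  step e w   ++ʷ w' = step e (w ++ʷ w')

  reverseOnto : ∀ {a b c k l} → Walk (adj G) a b k → Walk (adj G) a c l → Walk (adj G) b c (k + l)
  reverseOnto here acc = acc
  reverseOnto {l = l} (step {k = k} e w) acc =
    subst (Walk (adj G) _ _) (+-suc k l) (reverseOnto w (step (trans (symmetric G _ _) e) acc))

  reverse : ∀ {a b k} → Walk (adj G) a b k → Walk (adj G) b a k
  reverse {k = k} w = subst (Walk (adj G) _ _) (+-identityʳ k) (reverseOnto w here)

  dist-refl : ∀ {a r} → DistLe G a a r
  dist-refl = 0 , z≤n , here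

  dist-sym : ∀ {a b r} → DistLe G a b r → DistLe G b a r
  dist-sym (k , k≤r , w) = k , k≤r , reverse w

  dist-trans : ∀ {a b c r s} → DistLe G a b r → DistLe G b c s → DistLe G a c (r + s)
  dist-trans (k , k≤r , w) (l , l≤s , w') = k + l , +-mono-≤ k≤r l≤s , w ++ʷ w'

  distLe? : ∀ r a b → Dec (DistLe G a b r)
  distLe? r a b with a ≟ b
  ... | yes refl = yes dist-refl
  distLe? zero a b | no a≢b = no λ { (.0 , z≤n , here) → a≢b refl }
  distLe? (suc r) a b | no a≢b with any? (λ c → (adj G a c ≟ᵇ true) ×-dec distLe? r c b)
  ... | yes (c , e , (k , k≤r , w)) = yes (suc k , s≤s k≤r , step e w)
  ... | no none = no λ { (.0 , _ , here) → a≢b refl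
                       ; (suc k , s≤s k≤r , step e w) → none (_ , e , (k , k≤r , w)) }

module _ {N : ℕ} {p} (P : Pred (Fin N) p) (P? : Decidable P) (f : Fin N → ℕ) where

  private
    members = filter P? (allFin N)

  opaque
    maximise : ∀ {x} → P x → Σ (Fin N) λ y → P y × (∀ z → P z → f z ≤ f y)
    maximise {x} px =
      argmax f x members ,
      argmax-all f px (all-filter P? (allFin N)) ,
      λ z pz → lookup (f[xs]≤f[argmax] x members) (∈-filter⁺ P? (∈-allFin z) pz)

    minimise : ∀ {x} → P x → Σ (Fin N) λ y → P y × (∀ z → P z → f y ≤ f z)
    minimise {x} px =
      argmin f x members ,
      argmin-all f px (all-filter P? (allFin N)) ,
      λ z pz → lookup (f[argmin]≤f[xs] x members) (∈-filter⁺ P? (∈-allFin z) pz)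

module Trees (T : Tree) where
  open Tree T

  data _≼_ (a : Node) : Node → Set where
    self : a ≼ a
    down : ∀ {i} → a ≼ parent i → a ≼ suc i

  ≼⇒index≤ : ∀ {a b} → a ≼ b → toℕ a ≤ toℕ b
  ≼⇒index≤ self = ≤-refl
  ≼⇒index≤ (down {i} a≼p) = ≤-trans (≼⇒index≤ a≼p) (≤-trans (parent< i) (n≤1+n (toℕ i)))

  ≼-antisym-index : ∀ {a b} → a ≼ b → toℕ b ≤ toℕ a → a ≡ b
  ≼-antisym-index a≼b b≤a = toℕ-injective (≤-antisym (≼⇒index≤ a≼b) b≤a)

  pathMap : ∀ {P Q : Node → Set} →
            (∀ {x} → P x → Q x) → ∀ {a b} → TPathIn T P a b → TPathIn T Q a b
  pathMap f (here pa) = here (f pa)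
  pathMap f (step pa e path) = step (f pa) e (pathMap f path)

  module _ {P : Node → Set} where

    pathStart : ∀ {a b} → TPathIn T P a b → P a
    pathStart (here pa) = pa
    pathStart (step pa _ _) = pa

    _++ᵖ_ : ∀ {a b c} → TPathIn T P a b → TPathIn T P b c → TPathIn T P a c
    here _ ++ᵖ q = q
    step pa e path ++ᵖ q = step pa e (path ++ᵖ q)

    edge-sym : ∀ {a b} → TEdge a b → TEdge b a
    edge-sym (i , inj₁ e) = i , inj₂ e
    edge-sym (i , inj₂ e) = i , inj₁ e

    reverseOntoᵖ : ∀ {a b c} → TPathIn T P a b → TPathIn T P a c → TPathIn T P b c
    reverseOntoᵖ (here _) acc = acc
    reverseOntoᵖ (step _ e path) acc = reverseOntoᵖ path (step (pathStart path) (edge-sym e) acc)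

    reverseᵖ : ∀ {a b} → TPathIn T P a b → TPathIn T P b a
    reverseᵖ path = reverseOntoᵖ path (here (pathStart path))

    exit : ∀ {a b c} → TPathIn T P b c → a ≼ b →
           a ≼ c ⊎ Σ (Fin m) λ i → a ≡ suc i × P a × P (parent i)
    exit (here _) a≼b = inj₁ a≼b
    exit (step pa (i , inj₁ (refl , refl)) path) self = inj₂ (i , refl , pa , pathStart path)
    exit (step pa (i , inj₁ (refl , refl)) path) (down a≼p) = exit path a≼p
    exit (step pa (i , inj₂ (refl , refl)) path) a≼b = exit path (down a≼b)

  record Subtree : Set₁ where
    field
      member    : Node → Set
      member?   : Decidable member
      inhabited : ∃ member
      connected : ∀ {s t} → member s → member t → TPathIn T member s t
  open Subtree public

  -- Every subtree has a root, an ancestor of all its members: the member of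
  -- least index, since a path leaving it upwards would reach a smaller one.
  root : (X : Subtree) → Σ Node λ t → member X t × (∀ s → member X s → t ≼ s)
  root X with minimise (member X) (member? X) toℕ (proj₂ (inhabited X))
  ... | t , xt , least = t , xt , λ s xs → below (exit (connected X xt xs) self)
    where
      below : ∀ {s} → t ≼ s ⊎ Σ (Fin m) (λ i → t ≡ suc i × member X t × member X (parent i)) → t ≼ s
      below (inj₁ t≼s) = t≼s
      below (inj₂ (i , refl , _ , xp)) = ⊥-elim (<⇒≱ (s≤s (parent< i)) (least (parent i) xp))

  rootOf : Subtree → Node
  rootOf X = proj₁ (root X)

  root-member : ∀ X → member X (rootOf X)
  root-member X = proj₁ (proj₂ (root X))

  root-≼ : ∀ X {s} → member X s → rootOf X ≼ s
  root-≼ X {s} xs = proj₂ (proj₂ (root X)) s xs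

  -- The root
  -- u of greatest index works: another subtree meets X u below u and
  -- contains its own root, not strictly below u, so its connecting path
  -- passes through u.
  helly : ∀ {N} (S : Subset N) (X : Fin N → Subtree) →
          (∀ v w → v ∈ S → w ∈ S → ∃ λ t → member (X v) t × member (X w) t) →
          ∃ λ t → ∀ w → w ∈ S → member (X w) t
  helly S X meet with any? (_∈? S)
  ... | no empty = zero , λ w w∈S → ⊥-elim (empty (w , w∈S))
  ... | yes (_ , v∈S) with maximise (_∈ S) (_∈? S) (λ v → toℕ (rootOf (X v))) v∈S
  ... | u , u∈S , deepest = rootOf (X u) , containsRoot
    where
      containsRoot : ∀ w → w ∈ S → member (X w) (rootOf (X u))
      containsRoot w w∈S with meet u w u∈S w∈S
      ... | z , z∈Xu , z∈Xw with exit (connected (X w) z∈Xw (root-member (X w))) (root-≼ (X u) z∈Xu)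
      ... | inj₁ ru≼rw =
        subst (member (X w)) (sym (≼-antisym-index ru≼rw (deepest w w∈S))) (root-member (X w))
      ... | inj₂ (_ , _ , ru∈Xw , _) = ru∈Xw

module Decomposition {n : ℕ} {G : Graph n} (TD : TreeDecomposition G) where
  open Distances G
  open Trees (tree TD)

  MeetsDisk : Fin n → ℕ → Tree.Node (tree TD) → Set
  MeetsDisk v R t = ∃ λ x → x ∈ bag TD t × InDisk G x v R

  module _ (v : Fin n) (R : ℕ) where

    -- Following a walk from y to the centre v of length ≤ R, every vertex on
    -- it is in D(v,R), so its bags, chained along the walk's edges, connect
    -- a bag of y to a bag of v through bags meeting the disk.
    towardsCentre : ∀ {y k} → Walk (adj G) y v k → k ≤ R → ∀ {t s} →
                    y ∈ bag TD t → v ∈ bag TD s → TPathIn (tree TD) (MeetsDisk v R) t s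
    towardsCentre here _ v∈t v∈s =
      pathMap (λ v∈x → v , v∈x , dist-refl) (subtree TD v _ _ v∈t v∈s)
    towardsCentre {y} (step {v = y'} e w) k≤R y∈t v∈s with edges TD y y' e
    ... | m , y∈m , y'∈m =
      pathMap (λ y∈x → y , y∈x , dist-sym (_ , k≤R , step e w)) (subtree TD y _ _ y∈t y∈m)
      ++ᵖ towardsCentre w (≤-trans (n≤1+n _) k≤R) y'∈m v∈s

    diskSubtree : Subtree
    diskSubtree = record
      { member    = MeetsDisk v R
      ; member?   = λ t → any? (λ x → (x ∈? bag TD t) ×-dec distLe? R v x)
      ; inhabited = proj₁ (covers TD v) , v , proj₂ (covers TD v) , dist-refl
      ; connected = λ { (x , x∈s , k , k≤R , w) (x' , x'∈t , k' , k'≤R , w') →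
          let (c , v∈c) = covers TD v in
          towardsCentre (reverse w) k≤R x∈s v∈c ++ᵖ reverseᵖ (towardsCentre (reverse w') k'≤R x'∈t v∈c) }
      }

  disksMeet⇒subtreesMeet : ∀ {v w R R'} → (∃ λ x → InDisk G x v R × InDisk G x w R') →
                           ∃ λ t → MeetsDisk v R t × MeetsDisk w R' t
  disksMeet⇒subtreesMeet (x , x∈Dv , x∈Dw) =
    let (t , x∈t) = covers TD x in t , (x , x∈t , x∈Dv) , (x , x∈t , x∈Dw)

  -- α(G) ≤ tb(G): a bag meeting all the disks lies in D(c,ρ), so c ∈ D(v, r v + ρ)
  breadth⇒weaklyHelly : ∀ ρ → HasBreadth TD ρ → WeaklyHelly G ρ
  breadth⇒weaklyHelly ρ breadth S r pairwise
    with helly S (λ v → diskSubtree v (r v)) (λ v w v∈S w∈S → disksMeet⇒subtreesMeet (pairwise v w v∈S w∈S))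
  ... | t , meetsAll with breadth t
  ... | c , t⊆Dc = c , λ w w∈S → nearCentre (meetsAll w w∈S)
    where
      nearCentre : ∀ {w} → MeetsDisk w (r w) t → InDisk G c w (r w + ρ)
      nearCentre (x , x∈t , x∈Dw) = dist-trans x∈Dw (dist-sym (t⊆Dc x x∈t))

  -- tb(G) ≤ tl(G): centre each bag at one of its vertices (an empty bag at
  -- an arbitrary vertex, which is why one is supplied)
  length⇒breadth : Fin n → ∀ λ' → HasLength TD λ' → HasBreadth TD λ'
  length⇒breadth z λ' diameter t with any? (_∈? bag TD t)
  ... | yes (u , u∈t) = u , λ w w∈t → diameter t u w u∈t w∈t
  ... | no empty = z , λ w w∈t → ⊥-elim (empty (w , w∈t))

lemma21 : ∀ {n} (G : Graph (suc n)) →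
    ((ρ : ℕ) → TreeBreadthLe G ρ → WeaklyHelly G ρ) ×
    ((λ' : ℕ) → TreeLengthLe G λ' → TreeBreadthLe G λ')
lemma21 G =
  (λ ρ (TD , breadth) → Decomposition.breadth⇒weaklyHelly TD ρ breadth) ,
  (λ λ' (TD , diameter) → TD , Decomposition.length⇒breadth TD zero λ' diameter)
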